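{- Let $d \in \{2,3,5,6,7,11,13,17,19,21,29,33,37,41,57,73\}$ and let $\mathbb{D}[d]$ be the ring of integers of $\mathbb{Q}(\sqrt{d})$. For every $n \in \mathbb{D}[d] \setminus \{0\}$ there exist nonzero $a, b \in \mathbb{D}[d]$ such that $$\frac{4}{n} = \frac{1}{a} + \frac{1}{b}.$$
   Context: $\mathbb{D}[d]$ equals $\mathbb{Z}[\sqrt{d}]$ if $d \equiv 2,3 \pmod 4$ and $\mathbb{Z}[\tfrac{1+\sqrt{d}}{2}]$ if $d \equiv 1 \pmod 4$. The equation is read in $\mathbb{Q}(\sqrt{d})$. -}

module Defs where

open import Data.Nat using (ℕ)
open import Data.Integer as ℤ using (ℤ)
open import Data.Rational as ℚ using (ℚ; 0ℚ; 1ℚ; _≟_)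
open import Data.Product using (_×_; _,_; proj₁; proj₂)
open import Data.List using (List; _∷_; [])
open import Data.List.Membership.Propositional using (_∈_)
open import Relation.Nullary using (yes; no)
open import Relation.Binary.PropositionalEquality using (_≡_; _≢_)

Ds : List ℕ
Ds = 2 ∷ 3 ∷ 5 ∷ 6 ∷ 7 ∷ 11 ∷ 13 ∷ 17 ∷ 19 ∷ 21 ∷ 29 ∷ 33 ∷ 37 ∷ 41 ∷ 57 ∷ 73 ∷ []

-- d mod 4 = 1 ?  (decides the shape of the ring of integers)
data Mod4 : Set where
  one other : Mod4

mod4 : ℕ → Mod4
mod4 0 = other
mod4 1 = one
mod4 2 = other
mod4 3 = other
mod4 (ℕ.suc (ℕ.suc (ℕ.suc (ℕ.suc n)))) = mod4 n

-- Elements of the field Q(√d): p + q √d  encoded as (p , q).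
QF : Set
QF = ℚ × ℚ

module _ (d : ℕ) where
  private
    dq : ℚ
    dq = ℤ.+ d ℚ./ 1

  _⊕_ : QF → QF → QF
  (p , q) ⊕ (r , s) = (p ℚ.+ r , q ℚ.+ s)

  _⊗_ : QF → QF → QF
  (p , q) ⊗ (r , s) = (p ℚ.* r ℚ.+ dq ℚ.* q ℚ.* s , p ℚ.* s ℚ.+ q ℚ.* r)

  -- total reciprocal on ℚ (value at 0 irrelevant: only used on nonzero arguments)
  qinv : ℚ → ℚ
  qinv x with x ≟ 0ℚ
  ... | yes _ = 0ℚ
  ... | no x≢0 = ℚ.1/_ x {{ℚ.≢-nonZero x≢0}}

  -- field inverse in Q(√d): (p + q√d)⁻¹ = (p - q√d) / (p² - d q²)
  -- (for d not a square the norm of a nonzero element is nonzero)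
  inv : QF → QF
  inv (p , q) = let N = p ℚ.* p ℚ.- dq ℚ.* q ℚ.* q in
                (p ℚ.* qinv N , ℚ.- q ℚ.* qinv N)

-- Ring of integers D[d]: pairs of integers (x , y) meaning x + y ω,
-- ω = √d if d ≢ 1 mod 4, ω = (1 + √d)/2 if d ≡ 1 mod 4.
O : Set
O = ℤ × ℤ

embed : ℕ → O → QF
embed d (x , y) with mod4 d
... | other = (x ℚ./ 1 , y ℚ./ 1)
... | one   = ((ℤ.+ 2 ℤ.* x ℤ.+ y) ℚ./ 2 , y ℚ./ 2)

0O : O
0O = (ℤ.+ 0 , ℤ.+ 0)

four : QF
four = (ℤ.+ 4 ℚ./ 1 , 0ℚ)

module Submission where

-- If 4 = 1/a₀ + 1/b₀ with a₀, b₀ ∈ D[d] nonzero, then for every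
-- nonzero n ∈ D[d] we get 4/n = 1/(a₀n) + 1/(b₀n).  So the theorem reduces
-- to exhibiting one such pair (a₀ , b₀) for each of the sixteen values of d,
-- which is a finite computation.

open import Defs
open import Data.Nat as ℕ using (ℕ; suc)
import Data.Nat.Properties as ℕP
open import Data.Integer as ℤ using (ℤ; +_; -_)
import Data.Integer.Properties as ℤP
open import Data.Rational as ℚ using (ℚ; 0ℚ; 1ℚ; _≟_; toℚᵘ; fromℚᵘ)
import Data.Rational.Properties as ℚP
open import Data.Rational.Unnormalised as ℚᵘ using (mkℚᵘ; *≡*)
import Data.Rational.Unnormalised.Properties as ℚᵘP
open import Data.Rational.Solver using (module +-*-Solver)
open import Data.List.Membership.Propositional using (_∈_)
open import Data.List.Relation.Unary.All as All using (All; []; _∷_)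
open import Data.Product using (Σ; _×_; _,_; proj₁; proj₂)
open import Data.Empty using (⊥-elim)
open import Function using (_∘_)
open import Relation.Nullary using (yes; no)
open import Relation.Binary.PropositionalEquality

open +-*-Solver

ι : ℤ → ℚ
ι z = z ℚ./ 1

½ : ℚ
½ = + 1 ℚ./ 2

-- Normalisation ℚᵘ → ℚ turns addition and multiplication into those of ℚ;
-- this is how identities about the fractions z/k are reduced to integer ones.
fromℚᵘ-homo-+ : ∀ p q → fromℚᵘ (p ℚᵘ.+ q) ≡ fromℚᵘ p ℚ.+ fromℚᵘ q
fromℚᵘ-homo-+ p q = ℚP.toℚᵘ-injective (begin
  toℚᵘ (fromℚᵘ (p ℚᵘ.+ q))                   ≈⟨ ℚP.toℚᵘ-fromℚᵘ (p ℚᵘ.+ q) ⟩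
  p ℚᵘ.+ q                                   ≈⟨ ℚᵘP.+-cong (ℚᵘP.≃-sym (ℚP.toℚᵘ-fromℚᵘ p)) (ℚᵘP.≃-sym (ℚP.toℚᵘ-fromℚᵘ q)) ⟩
  toℚᵘ (fromℚᵘ p) ℚᵘ.+ toℚᵘ (fromℚᵘ q)       ≈⟨ ℚᵘP.≃-sym (ℚP.toℚᵘ-homo-+ (fromℚᵘ p) (fromℚᵘ q)) ⟩
  toℚᵘ (fromℚᵘ p ℚ.+ fromℚᵘ q)               ∎)
  where open ℚᵘP.≃-Reasoning

fromℚᵘ-homo-* : ∀ p q → fromℚᵘ (p ℚᵘ.* q) ≡ fromℚᵘ p ℚ.* fromℚᵘ q
fromℚᵘ-homo-* p q = ℚP.toℚᵘ-injective (begin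
  toℚᵘ (fromℚᵘ (p ℚᵘ.* q))                   ≈⟨ ℚP.toℚᵘ-fromℚᵘ (p ℚᵘ.* q) ⟩
  p ℚᵘ.* q                                   ≈⟨ ℚᵘP.*-cong (ℚᵘP.≃-sym (ℚP.toℚᵘ-fromℚᵘ p)) (ℚᵘP.≃-sym (ℚP.toℚᵘ-fromℚᵘ q)) ⟩
  toℚᵘ (fromℚᵘ p) ℚᵘ.* toℚᵘ (fromℚᵘ q)       ≈⟨ ℚᵘP.≃-sym (ℚP.toℚᵘ-homo-* (fromℚᵘ p) (fromℚᵘ q)) ⟩
  toℚᵘ (fromℚᵘ p ℚ.* fromℚᵘ q)               ∎)
  where open ℚᵘP.≃-Reasoning

ι-+ : ∀ x y → ι (x ℤ.+ y) ≡ ι x ℚ.+ ι y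
ι-+ x y = trans (ℚP.fromℚᵘ-cong {mkℚᵘ (x ℤ.+ y) 0} {mkℚᵘ x 0 ℚᵘ.+ mkℚᵘ y 0} (*≡* unnormalised)) (fromℚᵘ-homo-+ (mkℚᵘ x 0) (mkℚᵘ y 0))
  where
  unnormalised : (x ℤ.+ y) ℤ.* + 1 ≡ (x ℤ.* + 1 ℤ.+ y ℤ.* + 1) ℤ.* + 1
  unnormalised rewrite ℤP.*-identityʳ x | ℤP.*-identityʳ y = refl

ι-* : ∀ x y → ι (x ℤ.* y) ≡ ι x ℚ.* ι y
ι-* x y = fromℚᵘ-homo-* (mkℚᵘ x 0) (mkℚᵘ y 0)

/2≡ι*½ : ∀ z → z ℚ./ 2 ≡ ι z ℚ.* ½
/2≡ι*½ z = trans (ℚP.fromℚᵘ-cong {mkℚᵘ z 1} {mkℚᵘ z 0 ℚᵘ.* mkℚᵘ (+ 1) 1} (*≡* unnormalised)) (fromℚᵘ-homo-* (mkℚᵘ z 0) (mkℚᵘ (+ 1) 1))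
  where
  unnormalised : z ℤ.* + 2 ≡ (z ℤ.* + 1) ℤ.* + 2
  unnormalised rewrite ℤP.*-identityʳ z = refl

/-reflects-zero : ∀ z k → z ℚ./ suc k ≡ 0ℚ → z ≡ + 0
/-reflects-zero z k z/k≡0
  with ℚP.fromℚᵘ-injective {mkℚᵘ z k} {mkℚᵘ (+ 0) 0} (trans z/k≡0 (sym (ℚP.0/n≡0 1)))
... | *≡* z*1≡0 = trans (sym (ℤP.*-identityʳ z)) z*1≡0

qinv-nonzero : ∀ d x (x≢0 : x ≢ 0ℚ) → qinv d x ≡ ℚ.1/_ x {{ℚ.≢-nonZero x≢0}}
qinv-nonzero d x x≢0 with x ≟ 0ℚ
... | yes x≡0 = ⊥-elim (x≢0 x≡0)
... | no _    = refl

inverse-unique : ∀ x w .{{_ : ℚ.NonZero x}} → x ℚ.* w ≡ 1ℚ → w ≡ ℚ.1/ x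
inverse-unique x w xw≡1 = begin
  w                          ≡⟨ sym (ℚP.*-identityˡ w) ⟩
  1ℚ ℚ.* w                   ≡⟨ cong (ℚ._* w) (sym (ℚP.*-inverseˡ x)) ⟩
  ℚ.1/ x ℚ.* x ℚ.* w         ≡⟨ ℚP.*-assoc (ℚ.1/ x) x w ⟩
  ℚ.1/ x ℚ.* (x ℚ.* w)       ≡⟨ cong (ℚ.1/ x ℚ.*_) xw≡1 ⟩
  ℚ.1/ x ℚ.* 1ℚ              ≡⟨ ℚP.*-identityʳ (ℚ.1/ x) ⟩
  ℚ.1/ x                     ∎
  where open ≡-Reasoning

-- qinv is multiplicative on all of ℚ (0 included): this is what makes the
-- field inverse of Q(√d) multiplicative.
qinv-* : ∀ d x y → qinv d (x ℚ.* y) ≡ qinv d x ℚ.* qinv d y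
qinv-* d x y with x ≟ 0ℚ
... | yes refl = trans (cong (qinv d) (ℚP.*-zeroˡ y)) (sym (ℚP.*-zeroˡ (qinv d y)))
... | no x≢0 with y ≟ 0ℚ
...   | yes refl = trans (cong (qinv d) (ℚP.*-zeroʳ x)) (sym (ℚP.*-zeroʳ (ℚ.1/_ x {{ℚ.≢-nonZero x≢0}})))
...   | no y≢0 = trans (qinv-nonzero d (x ℚ.* y) xy≢0)
                   (sym (inverse-unique (x ℚ.* y) _ {{ℚ.≢-nonZero xy≢0}} xy*[1/x*1/y]≡1))
  where
  instance
    _ = ℚ.≢-nonZero x≢0
    _ = ℚ.≢-nonZero y≢0
  xy*[1/x*1/y]≡1 : (x ℚ.* y) ℚ.* (ℚ.1/ x ℚ.* ℚ.1/ y) ≡ 1ℚ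
  xy*[1/x*1/y]≡1 = begin
    (x ℚ.* y) ℚ.* (ℚ.1/ x ℚ.* ℚ.1/ y)
      ≡⟨ solve 4 (λ x y x' y' → (x :* y) :* (x' :* y') := (x :* x') :* (y :* y')) refl x y (ℚ.1/ x) (ℚ.1/ y) ⟩
    (x ℚ.* ℚ.1/ x) ℚ.* (y ℚ.* ℚ.1/ y)
      ≡⟨ cong₂ ℚ._*_ (ℚP.*-inverseʳ x) (ℚP.*-inverseʳ y) ⟩
    1ℚ ∎
    where open ≡-Reasoning
  xy≢0 : x ℚ.* y ≢ 0ℚ
  xy≢0 xy≡0 = ℚP.1≢0 (begin
    1ℚ                                 ≡⟨ sym xy*[1/x*1/y]≡1 ⟩
    (x ℚ.* y) ℚ.* (ℚ.1/ x ℚ.* ℚ.1/ y)  ≡⟨ cong (ℚ._* (ℚ.1/ x ℚ.* ℚ.1/ y)) xy≡0 ⟩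
    0ℚ ℚ.* (ℚ.1/ x ℚ.* ℚ.1/ y)         ≡⟨ ℚP.*-zeroˡ (ℚ.1/ x ℚ.* ℚ.1/ y) ⟩
    0ℚ                                 ∎)
    where open ≡-Reasoning

𝟙 𝟘 : QF
𝟙 = (1ℚ , 0ℚ)
𝟘 = (0ℚ , 0ℚ)

module _ (d : ℕ) where
  private
    infixl 7 _·_
    infixl 6 _⊹_
    _·_ _⊹_ : QF → QF → QF
    _·_ = _⊗_ d
    _⊹_ = _⊕_ d
    D : ℚ
    D = ι (+ d)

  norm : QF → ℚ
  norm (p , q) = p ℚ.* p ℚ.- D ℚ.* q ℚ.* q

  norm-* : ∀ X Y → norm (X · Y) ≡ norm X ℚ.* norm Y
  norm-* (p , q) (r , s) = solve 5 (λ D p q r s →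
      (p :* r :+ D :* q :* s) :* (p :* r :+ D :* q :* s) :- D :* (p :* s :+ q :* r) :* (p :* s :+ q :* r)
    := (p :* p :- D :* q :* q) :* (r :* r :- D :* s :* s)) refl D p q r s

  inv-* : ∀ X Y → inv d (X · Y) ≡ inv d X · inv d Y
  inv-* X@(p , q) Y@(r , s) = begin
    inv d (X · Y)
      ≡⟨⟩
    (P ℚ.* qinv d (norm (X · Y)) , ℚ.- Q ℚ.* qinv d (norm (X · Y)))
      ≡⟨ cong (λ c → (P ℚ.* c , ℚ.- Q ℚ.* c)) qinv-norm-* ⟩
    (P ℚ.* (cX ℚ.* cY) , ℚ.- Q ℚ.* (cX ℚ.* cY))
      ≡⟨ cong₂ _,_
           (solve 7 (λ D p q r s cX cY → (p :* r :+ D :* q :* s) :* (cX :* cY)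
                      := p :* cX :* (r :* cY) :+ D :* (:- q :* cX) :* (:- s :* cY)) refl D p q r s cX cY)
           (solve 7 (λ D p q r s cX cY → :- (p :* s :+ q :* r) :* (cX :* cY)
                      := p :* cX :* (:- s :* cY) :+ (:- q :* cX) :* (r :* cY)) refl D p q r s cX cY) ⟩
    inv d X · inv d Y ∎
    where
    open ≡-Reasoning
    P Q cX cY : ℚ
    P = p ℚ.* r ℚ.+ D ℚ.* q ℚ.* s
    Q = p ℚ.* s ℚ.+ q ℚ.* r
    cX = qinv d (norm X)
    cY = qinv d (norm Y)
    qinv-norm-* : qinv d (norm (X · Y)) ≡ cX ℚ.* cY
    qinv-norm-* = trans (cong (qinv d) (norm-* X Y)) (qinv-* d (norm X) (norm Y))

  ·-assoc : ∀ X Y Z → (X · Y) · Z ≡ X · (Y · Z)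
  ·-assoc (a , a') (b , b') (c , c') = cong₂ _,_
    (solve 7 (λ D a a' b b' c c' → (a :* b :+ D :* a' :* b') :* c :+ D :* (a :* b' :+ a' :* b) :* c'
               := a :* (b :* c :+ D :* b' :* c') :+ D :* a' :* (b :* c' :+ b' :* c)) refl D a a' b b' c c')
    (solve 7 (λ D a a' b b' c c' → (a :* b :+ D :* a' :* b') :* c' :+ (a :* b' :+ a' :* b) :* c
               := a :* (b :* c' :+ b' :* c) :+ a' :* (b :* c :+ D :* b' :* c')) refl D a a' b b' c c')

  ·-identityˡ : ∀ X → 𝟙 · X ≡ X
  ·-identityˡ (a , a') = cong₂ _,_
    (solve 3 (λ D a a' → con 1ℚ :* a :+ D :* con 0ℚ :* a' := a) refl D a a')
    (solve 2 (λ a a' → con 1ℚ :* a' :+ con 0ℚ :* a := a') refl a a')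

  ·-zeroʳ : ∀ X → X · 𝟘 ≡ 𝟘
  ·-zeroʳ (a , a') = cong₂ _,_
    (solve 3 (λ D a a' → a :* con 0ℚ :+ D :* a' :* con 0ℚ := con 0ℚ) refl D a a')
    (solve 2 (λ a a' → a :* con 0ℚ :+ a' :* con 0ℚ := con 0ℚ) refl a a')

  ·-distribʳ-⊹ : ∀ X A B → (A ⊹ B) · X ≡ (A · X) ⊹ (B · X)
  ·-distribʳ-⊹ (n , n') (a , a') (b , b') = cong₂ _,_
    (solve 7 (λ D a a' b b' n n' → (a :+ b) :* n :+ D :* (a' :+ b') :* n'
               := a :* n :+ D :* a' :* n' :+ (b :* n :+ D :* b' :* n')) refl D a a' b b' n n')
    (solve 6 (λ a a' b b' n n' → (a :+ b) :* n' :+ (a' :+ b') :* n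
               := a :* n' :+ a' :* n :+ (b :* n' :+ b' :* n)) refl a a' b b' n n')

mulSqrt : ℕ → O → O → O
mulSqrt d (x , y) (u , v) = (x ℤ.* u ℤ.+ + d ℤ.* y ℤ.* v , x ℤ.* v ℤ.+ y ℤ.* u)

-- For d = 4k + 1, D[d] is ℤ[ω] with ω = (1 + √d)/2 and ω² = ω + k.
mulHalf : ℤ → O → O → O
mulHalf k (x , y) (u , v) = (x ℤ.* u ℤ.+ k ℤ.* y ℤ.* v , x ℤ.* v ℤ.+ y ℤ.* u ℤ.+ y ℤ.* v)

quarter : ℕ → ℕ
quarter (suc (suc (suc (suc n)))) = suc (quarter n)
quarter _ = 0

mod4≡one⇒ : ∀ d → mod4 d ≡ one → d ≡ 1 ℕ.+ 4 ℕ.* quarter d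
mod4≡one⇒ 1 _ = refl
mod4≡one⇒ (suc (suc (suc (suc n)))) eq rewrite ℕP.*-suc 4 (quarter n) = cong (4 ℕ.+_) (mod4≡one⇒ n eq)

-- The same fact read in ℚ; it is what makes ω² = ω + k hold in Q(√d).
mod4≡one⇒ι : ∀ d → mod4 d ≡ one → ι (+ d) ≡ ι (+ 4) ℚ.* ι (+ quarter d) ℚ.+ 1ℚ
mod4≡one⇒ι d eq = begin
  ι (+ d)                                        ≡⟨ cong (ι ∘ +_) (trans (mod4≡one⇒ d eq) (ℕP.+-comm 1 _)) ⟩
  ι (+ (4 ℕ.* quarter d ℕ.+ 1))                  ≡⟨ cong ι (trans (ℤP.pos-+ (4 ℕ.* quarter d) 1) (cong (ℤ._+ + 1) (ℤP.pos-* 4 (quarter d)))) ⟩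
  ι (+ 4 ℤ.* + quarter d ℤ.+ + 1)                ≡⟨ trans (ι-+ (+ 4 ℤ.* + quarter d) (+ 1)) (cong (ℚ._+ 1ℚ) (ι-* (+ 4) (+ quarter d))) ⟩
  ι (+ 4) ℚ.* ι (+ quarter d) ℚ.+ 1ℚ             ∎
  where open ≡-Reasoning

ringMul : ℕ → O → O → O
ringMul d with mod4 d
... | other = mulSqrt d
... | one   = mulHalf (+ quarter d)

embedSqrt embedHalf : O → QF
embedSqrt (x , y) = (ι x , ι y)
embedHalf (x , y) = ((+ 2 ℤ.* x ℤ.+ y) ℚ./ 2 , y ℚ./ 2)

embedSqrt-* : ∀ d a b → embedSqrt (mulSqrt d a b) ≡ _⊗_ d (embedSqrt a) (embedSqrt b)
embedSqrt-* d (x , y) (u , v) = cong₂ _,_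
  (trans (ι-+ (x ℤ.* u) (+ d ℤ.* y ℤ.* v))
         (cong₂ ℚ._+_ (ι-* x u) (trans (ι-* (+ d ℤ.* y) v) (cong (ℚ._* ι v) (ι-* (+ d) y)))))
  (trans (ι-+ (x ℤ.* v) (y ℤ.* u)) (cong₂ ℚ._+_ (ι-* x v) (ι-* y u)))

embedHalf-coords : ∀ x y → embedHalf (x , y) ≡ ((ι (+ 2) ℚ.* ι x ℚ.+ ι y) ℚ.* ½ , ι y ℚ.* ½)
embedHalf-coords x y = cong₂ _,_
  (trans (/2≡ι*½ (+ 2 ℤ.* x ℤ.+ y)) (cong (ℚ._* ½) (trans (ι-+ (+ 2 ℤ.* x) y) (cong (ℚ._+ ι y) (ι-* (+ 2) x)))))
  (/2≡ι*½ y)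

embedHalf-* : ∀ d k → ι (+ d) ≡ ι (+ 4) ℚ.* ι k ℚ.+ 1ℚ →
              ∀ a b → embedHalf (mulHalf k a b) ≡ _⊗_ d (embedHalf a) (embedHalf b)
embedHalf-* d k d≡4k+1 (x , y) (u , v) = begin
  embedHalf (mulHalf k (x , y) (u , v))
    ≡⟨ embedHalf-coords (x ℤ.* u ℤ.+ k ℤ.* y ℤ.* v) w ⟩
  ((ι2 ℚ.* ι (x ℤ.* u ℤ.+ k ℤ.* y ℤ.* v) ℚ.+ ι w) ℚ.* ½ , ι w ℚ.* ½)
    ≡⟨ cong₂ (λ s t → ((ι2 ℚ.* s ℚ.+ t) ℚ.* ½ , t ℚ.* ½)) ι-first ι-second ⟩
  ((ι2 ℚ.* (X ℚ.* U ℚ.+ K ℚ.* Y ℚ.* V) ℚ.+ W) ℚ.* ½ , W ℚ.* ½)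
    ≡⟨ cong₂ _,_
         (solve 5 (λ X Y U V K → (c2 :* (X :* U :+ K :* Y :* V) :+ (X :* V :+ Y :* U :+ Y :* V)) :* c½
            := (c2 :* X :+ Y) :* c½ :* ((c2 :* U :+ V) :* c½) :+ (con (ι (+ 4)) :* K :+ con 1ℚ) :* (Y :* c½) :* (V :* c½))
            refl X Y U V K)
         (solve 4 (λ X Y U V → (X :* V :+ Y :* U :+ Y :* V) :* c½
            := (c2 :* X :+ Y) :* c½ :* (V :* c½) :+ (Y :* c½) :* ((c2 :* U :+ V) :* c½))
            refl X Y U V) ⟩
  product (ι (+ 4) ℚ.* K ℚ.+ 1ℚ) (coords X Y) (coords U V)
    ≡⟨ cong (λ D → product D (coords X Y) (coords U V)) (sym d≡4k+1) ⟩
  _⊗_ d (coords X Y) (coords U V)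
    ≡⟨ sym (cong₂ (_⊗_ d) (embedHalf-coords x y) (embedHalf-coords u v)) ⟩
  _⊗_ d (embedHalf (x , y)) (embedHalf (u , v)) ∎
  where
  open ≡-Reasoning
  ι2 X Y U V K W : ℚ
  ι2 = ι (+ 2)
  X = ι x
  Y = ι y
  U = ι u
  V = ι v
  K = ι k
  W = X ℚ.* V ℚ.+ Y ℚ.* U ℚ.+ Y ℚ.* V
  w : ℤ
  w = x ℤ.* v ℤ.+ y ℤ.* u ℤ.+ y ℤ.* v
  c2 c½ : ∀ {n} → Polynomial n
  c2 = con ι2
  c½ = con ½
  coords : ℚ → ℚ → QF
  coords X Y = ((ι2 ℚ.* X ℚ.+ Y) ℚ.* ½ , Y ℚ.* ½)
  product : ℚ → QF → QF → QF
  product D (p , q) (r , s) = (p ℚ.* r ℚ.+ D ℚ.* q ℚ.* s , p ℚ.* s ℚ.+ q ℚ.* r)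
  ι-first : ι (x ℤ.* u ℤ.+ k ℤ.* y ℤ.* v) ≡ X ℚ.* U ℚ.+ K ℚ.* Y ℚ.* V
  ι-first = trans (ι-+ (x ℤ.* u) (k ℤ.* y ℤ.* v))
                  (cong₂ ℚ._+_ (ι-* x u) (trans (ι-* (k ℤ.* y) v) (cong (ℚ._* V) (ι-* k y))))
  ι-second : ι w ≡ W
  ι-second = trans (ι-+ (x ℤ.* v ℤ.+ y ℤ.* u) (y ℤ.* v))
                   (cong₂ ℚ._+_ (trans (ι-+ (x ℤ.* v) (y ℤ.* u)) (cong₂ ℚ._+_ (ι-* x v) (ι-* y u))) (ι-* y v))

embed-ringMul : ∀ d a b → embed d (ringMul d a b) ≡ _⊗_ d (embed d a) (embed d b)
embed-ringMul d (x , y) (u , v) with mod4 d in d≡1mod4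
... | other = embedSqrt-* d (x , y) (u , v)
... | one   = embedHalf-* d (+ quarter d) (mod4≡one⇒ι d d≡1mod4) (x , y) (u , v)

embed-0O : ∀ d → embed d 0O ≡ 𝟘
embed-0O d with mod4 d
... | other = refl
... | one   = refl

embed-reflects-zero : ∀ d n → embed d n ≡ 𝟘 → n ≡ 0O
embed-reflects-zero d (x , y) En≡0 with mod4 d
... | other = cong₂ _,_ (/-reflects-zero x 0 (cong proj₁ En≡0)) (/-reflects-zero y 0 (cong proj₂ En≡0))
... | one with /-reflects-zero y 1 (cong proj₂ En≡0)
...   | refl = cong (_, + 0) (ℤP.*-cancelˡ-≡ (+ 2) x (+ 0)
                  (trans (sym (ℤP.+-identityʳ (+ 2 ℤ.* x))) (/-reflects-zero (+ 2 ℤ.* x ℤ.+ + 0) 1 (cong proj₁ En≡0))))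

IsUnit : ℕ → QF → Set
IsUnit d X = _⊗_ d (inv d X) X ≡ 𝟙

ringMul-nonzero : ∀ d c n → IsUnit d (embed d c) → n ≢ 0O → ringMul d c n ≢ 0O
ringMul-nonzero d c n c-unit n≢0 cn≡0 = n≢0 (embed-reflects-zero d n (begin
  E n                      ≡⟨ sym (·-identityˡ d (E n)) ⟩
  𝟙 · E n                  ≡⟨ cong (_· E n) (sym c-unit) ⟩
  (inv d (E c) · E c) · E n ≡⟨ ·-assoc d (inv d (E c)) (E c) (E n) ⟩
  inv d (E c) · (E c · E n) ≡⟨ cong (inv d (E c) ·_) (sym (embed-ringMul d c n)) ⟩
  inv d (E c) · E (ringMul d c n) ≡⟨ cong (λ m → inv d (E c) · E m) cn≡0 ⟩
  inv d (E c) · E 0O       ≡⟨ cong (inv d (E c) ·_) (embed-0O d) ⟩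
  inv d (E c) · 𝟘          ≡⟨ ·-zeroʳ d (inv d (E c)) ⟩
  𝟘                        ∎))
  where
  open ≡-Reasoning
  E : O → QF
  E = embed d
  _·_ : QF → QF → QF
  _·_ = _⊗_ d

record FourSplitting (d : ℕ) : Set where
  constructor splitting
  field
    a₀ b₀ : O
    a₀-unit : IsUnit d (embed d a₀)
    b₀-unit : IsUnit d (embed d b₀)
    sum≡4 : _⊕_ d (inv d (embed d a₀)) (inv d (embed d b₀)) ≡ four

-- One splitting of 4 gives all: 4/n = (1/a₀ + 1/b₀)/n = 1/(a₀n) + 1/(b₀n).
splitting⇒erdős-straus : ∀ d → FourSplitting d → (n : O) → n ≢ 0O →
    Σ O (λ a → Σ O (λ b → a ≢ 0O × b ≢ 0O ×
      _⊗_ d four (inv d (embed d n)) ≡ _⊕_ d (inv d (embed d a)) (inv d (embed d b))))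
splitting⇒erdős-straus d (splitting a₀ b₀ a₀-unit b₀-unit sum≡4) n n≢0 =
  ringMul d a₀ n , ringMul d b₀ n ,
  ringMul-nonzero d a₀ n a₀-unit n≢0 , ringMul-nonzero d b₀ n b₀-unit n≢0 ,
  (begin
    four · inv d (E n)                                   ≡⟨ cong (_· inv d (E n)) (sym sum≡4) ⟩
    (inv d (E a₀) ⊹ inv d (E b₀)) · inv d (E n)          ≡⟨ ·-distribʳ-⊹ d (inv d (E n)) (inv d (E a₀)) (inv d (E b₀)) ⟩
    inv d (E a₀) · inv d (E n) ⊹ inv d (E b₀) · inv d (E n) ≡⟨ sym (cong₂ _⊹_ (inv-* d (E a₀) (E n)) (inv-* d (E b₀) (E n))) ⟩
    inv d (E a₀ · E n) ⊹ inv d (E b₀ · E n)              ≡⟨ sym (cong₂ (λ A B → inv d A ⊹ inv d B) (embed-ringMul d a₀ n) (embed-ringMul d b₀ n)) ⟩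
    inv d (E (ringMul d a₀ n)) ⊹ inv d (E (ringMul d b₀ n)) ∎)
  where
  open ≡-Reasoning
  E : O → QF
  E = embed d
  infixl 7 _·_
  infixl 6 _⊹_
  _·_ _⊹_ : QF → QF → QF
  _·_ = _⊗_ d
  _⊹_ = _⊕_ d

splittings : All FourSplitting Ds
splittings =
  splitting (- + 4 , - + 3) (- + 4 , + 3) refl refl refl ∷              -- d = 2
  splitting (+ 2 , + 1) (+ 2 , - + 1) refl refl refl ∷                  -- d = 3
  splitting (- + 1 , - + 2) (- + 3 , + 2) refl refl refl ∷              -- d = 5
  splitting (- + 12 , - + 5) (- + 12 , + 5) refl refl refl ∷            -- d = 6
  splitting (+ 32 , + 12) (+ 32 , - + 12) refl refl refl ∷              -- d = 7
  splitting (+ 50 , + 15) (+ 50 , - + 15) refl refl refl ∷              -- d = 11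
  splitting (- + 117 , - + 90) (- + 207 , + 90) refl refl refl ∷        -- d = 13
  splitting (- + 6 , - + 4) (- + 10 , + 4) refl refl refl ∷             -- d = 17
  splitting (+ 14450 , + 3315) (+ 14450 , - + 3315) refl refl refl ∷    -- d = 19
  splitting (+ 11 , + 6) (+ 17 , - + 6) refl refl refl ∷                -- d = 21
  splitting (- + 1995 , - + 910) (- + 2905 , + 910) refl refl refl ∷    -- d = 29
  splitting (+ 5 , + 2) (+ 7 , - + 2) refl refl refl ∷                  -- d = 33
  splitting (- + 15 , - + 6) (- + 21 , + 6) refl refl refl ∷            -- d = 37
  splitting (- + 432 , - + 160) (- + 592 , + 160) refl refl refl ∷      -- d = 41
  splitting (+ 33 , + 10) (+ 43 , - + 10) refl refl refl ∷              -- d = 57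
  splitting (- + 503562 , - + 133500) (- + 637062 , + 133500) refl refl refl ∷ -- d = 73
  []

theorem3 : (d : ℕ) → d ∈ Ds → (n : O) → n ≢ 0O →
    Σ O (λ a → Σ O (λ b → a ≢ 0O × b ≢ 0O ×
      _⊗_ d four (inv d (embed d n)) ≡ _⊕_ d (inv d (embed d a)) (inv d (embed d b))))
theorem3 d d∈Ds = splitting⇒erdős-straus d (All.lookup splittings d∈Ds)
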